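{- Let $\mathcal{T} = \{T_1,\dots,T_t\}$ be a set of unrooted binary phylogenetic trees on leaf set $X$, and let $\tilde x$ be an optimal solution of the LP $$\text{Minimize } \sum_{e \in E(T_1)} x_e \quad \text{s.t. } \sum_{e \in L(Q)} x_e \ge 1 \ \ \forall Q \in \mathcal{Q}, \qquad x_e \ge 0 \ \ \forall e \in E(T_1).$$ Run the following procedure: choose an arbitrary leaf $r$ of $T_1$ as root; set $E=\emptyset$; repeatedly pick any edge $e$ satisfying condition (*) — namely $w(e) \ge 1/4$ and $w(f) < 1/4$ for all $f \in D(e)\setminus\{e\}$ — and add it to $E$, until every edge $e \in E(T_1)\setminus E$ satisfies $w(e) < 1/4$. Then the final set $E$ is a feasible solution of the integer program $$\text{Minimize } \sum_{e \in E(T_1)} x_e \quad \text{s.t. } \sum_{e \in L(Q)} x_e \ge 1 \ \ \forall Q \in \mathcal{Q}, \qquad x_e \in \{0,1\}\ \ \forall e \in E(T_1),$$ i.e. $L(Q) \cap E \neq \emptyset$ for every $Q \in \mathcal{Q}$.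
   Context: A phylogenetic tree on $X$ is an unrooted tree with all internal vertices of degree 3 and leaves bijectively labelled by $X$. For $Y\subseteq X$, $T[Y]$ is the minimal subtree connecting $Y$, and $T|_Y$ is $T[Y]$ with degree-2 vertices suppressed; trees on the same labels are isomorphic if there is a label-preserving graph isomorphism. A quartet is a 4-element subset of $X$; for $Q = \{a,b,c,d\}$, $ab|cd$ is the tree on $Q$ where $a,b$ share a neighbour, $c,d$ share a neighbour, and these two neighbours are adjacent. If $T_1|_Q \cong ab|cd$, $L(Q)$ is the edge set of $T_1[\{a,b\}] \cup T_1[\{c,d\}]$. $\mathcal{Q}$ is the set of quartets $Q$ such that $T_1|_Q \not\cong T_i|_Q$ for some $2 \le i \le t$. A 0/1 vector $x$ is identified with the edge set $\{e : x_e = 1\}$. In the procedure, with $T_1$ rooted at leaf $r$, each edge $e$ has endpoints $u_e, v_e$ with $u_e$ on the path from $r$ to $v_e$. For the current set $E$, $D(e)$ is the set of edges $f$ such that $v_e$ lies on the path from $r$ to $v_f$ and the path from $v_e$ to $v_f$ contains no edge of $E$ (so $e\in D(e)$), and $w(e) = \sum_{f \in D(e)} \tilde x_f$; these are recomputed as $E$ grows.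
   Formalization: The optimal LP solution $\tilde x$ takes values in the rationals, and its optimality is compared only against rational feasible solutions of the LP. -}

module Defs where

open import Data.Nat using (ℕ; zero; suc)
open import Data.Fin using (Fin; zero; suc; _≟_)
open import Data.Fin.Subset using (Subset; _∈_; _∉_; _∪_; ⁅_⁆) renaming (⊥ to ∅)
open import Data.Vec using (lookup)
open import Data.Bool using (Bool; true; false; if_then_else_; _∨_)
open import Data.List using (List; []; _∷_; length; filterᵇ; allFin)
open import Data.List.Membership.Propositional using () renaming (_∈_ to _∈ₗ_)
open import Data.List.Relation.Unary.Unique.Propositional using (Unique)
open import Data.Product using (Σ; ∃; _×_; _,_; proj₁; proj₂)
open import Data.Sum using (_⊎_)
open import Data.Integer using (+_)
open import Data.Rational using (ℚ; 0ℚ; 1ℚ; _+_; _≤_; _<_; _/_)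
open import Relation.Nullary using (¬_; ⌊_⌋)
open import Relation.Binary.PropositionalEquality using (_≡_; _≢_)
open import Relation.Binary.Construct.Closure.ReflexiveTransitive using (Star)
open import Function.Bundles using (_⇔_)

sumFin : ∀ {k} → (Fin k → ℚ) → ℚ
sumFin {zero}  f = 0ℚ
sumFin {suc k} f = f zero + sumFin (λ i → f (suc i))

sumSub : ∀ {k} → Subset k → (Fin k → ℚ) → ℚ
sumSub S x = sumFin (λ e → if lookup S e then x e else 0ℚ)

Represents : ∀ {k} → Subset k → (Fin k → Set) → Set
Represents S P = ∀ e → (e ∈ S → P e) × (P e → e ∈ S)

record Graph : Set where
  field
    m    : ℕ
    k    : ℕ
    ends : Fin k → Fin m × Fin m

  Joins : Fin k → Fin m → Fin m → Set
  Joins e u v = (ends e ≡ (u , v)) ⊎ (ends e ≡ (v , u))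

  data Walk : Fin m → Fin m → Set where
    here : ∀ v → Walk v v
    step : ∀ {u w v} (e : Fin k) → Joins e u w → Walk w v → Walk u v

  verts : ∀ {u v} → Walk u v → List (Fin m)
  verts (here v)           = v ∷ []
  verts (step {u} e _ p)   = u ∷ verts p

  edgesW : ∀ {u v} → Walk u v → List (Fin k)
  edgesW (here v)         = []
  edgesW (step e _ p)     = e ∷ edgesW p

  Path : Fin m → Fin m → Set
  Path u v = Σ (Walk u v) (λ p → Unique (verts p))

  VOnPath : Fin m → Fin m → Fin m → Set
  VOnPath u v w = Σ (Path u v) (λ p → w ∈ₗ verts (proj₁ p))

  EOnPath : Fin m → Fin m → Fin k → Set
  EOnPath u v e = Σ (Path u v) (λ p → e ∈ₗ edgesW (proj₁ p))

  incident : Fin k → Fin m → Bool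
  incident e v = ⌊ proj₁ (ends e) ≟ v ⌋ ∨ ⌊ proj₂ (ends e) ≟ v ⌋

  degree : Fin m → ℕ
  degree v = length (filterᵇ (λ e → incident e v) (allFin k))

  Connected : Set
  Connected = ∀ u v → Walk u v

record PhyloTree (n : ℕ) : Set where
  field
    graph      : Graph
  open Graph graph public
  field
    leaf       : Fin n → Fin m
    -- tree: connected with |V| = |E| + 1
    connected  : Connected
    vertCount  : m ≡ suc k
    leaf-inj   : ∀ x y → leaf x ≡ leaf y → x ≡ y
    leaf-deg   : ∀ x → degree (leaf x) ≡ 1
    inner-deg  : ∀ v → (∀ x → leaf x ≢ v) → degree v ≡ 3

module _ {n : ℕ} where
  open PhyloTree

  -- T|_{a,b,c,d} ≅ ab|cd : the a–b path and the c–d path are vertex-disjoint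
  Displays : PhyloTree n → Fin n → Fin n → Fin n → Fin n → Set
  Displays T a b c d =
    ∀ w → VOnPath T (leaf T a) (leaf T b) w → VOnPath T (leaf T c) (leaf T d) w → ⊥'
    where open import Data.Empty renaming (⊥ to ⊥')

  SameQuartet : PhyloTree n → PhyloTree n → Fin n → Fin n → Fin n → Fin n → Set
  SameQuartet T T' a b c d =
    (Displays T a b c d ⇔ Displays T' a b c d) ×
    (Displays T a c b d ⇔ Displays T' a c b d) ×
    (Displays T a d b c ⇔ Displays T' a d b c)

  Distinct4 : Fin n → Fin n → Fin n → Fin n → Set
  Distinct4 a b c d = a ≢ b × a ≢ c × a ≢ d × b ≢ c × b ≢ d × c ≢ d

  -- {a,b,c,d} ∈ 𝒬  for T₁ and the other trees T₂,…,T_t (indexed by Fin s)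
  InQ : PhyloTree n → ∀ {s} → (Fin s → PhyloTree n) → Fin n → Fin n → Fin n → Fin n → Set
  InQ T₁ Ts a b c d = Distinct4 a b c d × ∃ (λ i → ¬ SameQuartet T₁ (Ts i) a b c d)

  -- e ∈ L(Q), when T₁|_Q ≅ ab|cd
  InL : (T : PhyloTree n) → Fin n → Fin n → Fin n → Fin n → Fin (k T) → Set
  InL T a b c d e = EOnPath T (leaf T a) (leaf T b) e ⊎ EOnPath T (leaf T c) (leaf T d) e

  LPFeasible : (T₁ : PhyloTree n) → ∀ {s} → (Fin s → PhyloTree n) → (Fin (k T₁) → ℚ) → Set
  LPFeasible T₁ Ts x =
    (∀ e → 0ℚ ≤ x e) ×
    (∀ a b c d → InQ T₁ Ts a b c d → Displays T₁ a b c d →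
       ∀ S → Represents S (InL T₁ a b c d) → 1ℚ ≤ sumSub S x)

  LPOptimal : (T₁ : PhyloTree n) → ∀ {s} → (Fin s → PhyloTree n) → (Fin (k T₁) → ℚ) → Set
  LPOptimal T₁ Ts x =
    LPFeasible T₁ Ts x ×
    (∀ y → LPFeasible T₁ Ts y → sumFin x ≤ sumFin y)

  IPFeasible : (T₁ : PhyloTree n) → ∀ {s} → (Fin s → PhyloTree n) → Subset (k T₁) → Set
  IPFeasible T₁ Ts E =
    ∀ a b c d → InQ T₁ Ts a b c d → Displays T₁ a b c d →
      ∃ (λ e → e ∈ E × InL T₁ a b c d e)

  module Procedure (T : PhyloTree n) (r : Fin n) (x : Fin (k T) → ℚ) where

    root : Fin (m T)
    root = leaf T r

    -- v is the endpoint v_e of e, i.e. the other endpoint u_e lies on the path r → v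
    Lower : Fin (k T) → Fin (m T) → Set
    Lower e v = ∃ (λ u → Joins T e u v × VOnPath T root v u)

    InD : Subset (k T) → Fin (k T) → Fin (k T) → Set
    InD E e f = ∃ (λ ve → ∃ (λ vf →
      Lower e ve × Lower f vf × VOnPath T root vf ve ×
      (∀ g → g ∈ E → ¬ EOnPath T ve vf g)))

    WeightIs : Subset (k T) → Fin (k T) → ℚ → Set
    WeightIs E e q = Σ (Subset (k T)) (λ S → Represents S (InD E e) × sumSub S x ≡ q)

    quarter : ℚ
    quarter = + 1 / 4

    WeightGE : Subset (k T) → Fin (k T) → Set
    WeightGE E e = ∃ (λ q → WeightIs E e q × quarter ≤ q)

    WeightLT : Subset (k T) → Fin (k T) → Set
    WeightLT E e = ∃ (λ q → WeightIs E e q × q < quarter)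

    Cond : Subset (k T) → Fin (k T) → Set
    Cond E e = WeightGE E e × (∀ f → InD E e f → f ≢ e → WeightLT E f)

    Step : Subset (k T) → Subset (k T) → Set
    Step E E' = ∃ (λ e → Cond E e × E' ≡ E ∪ ⁅ e ⁆)

    Reachable : Subset (k T) → Set
    Reachable E = Star Step ∅ E

    Stopped : Subset (k T) → Set
    Stopped E = ∀ e → e ∉ E → WeightLT E e

{-# OPTIONS --safe #-}

-- Root T₁ at r. Every vertex w ≠ r has a parent edge, w ↦ parentEdge w is a bijection onto the
-- edges, and parentEdge w lies on the y–z path iff exactly one of y, z is in the subtree of w.
-- Suppose no edge of L(Q) = P(a,b) ∪ P(c,d) lies in E. Each path P(y,z) splits at the lowest
-- common ancestor of y and z into two branches. The top edge f of a branch is not in E, so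
-- w(f) < 1/4 by the stopping condition, and the whole branch lies in D(f) because no edge of
-- E lies between f and it. Hence x̃(L(Q)) < 4 · 1/4 = 1, contradicting the LP constraint for Q.
module Submission where

open import Defs
open import Data.Nat using (ℕ)
open import Data.Fin using (Fin)
open import Data.Fin.Subset using (Subset)
open import Data.Rational using (ℚ)

open import Algebra.Bundles using (CommutativeMonoid)
open import Data.Bool using (true; false; if_then_else_; _∨_)
open import Data.Fin using (zero; suc; _≟_)
open import Data.Fin.Properties using (any?; injective⇒≤)
open import Data.Fin.Subset using (_∈_; _∉_; _⊆_; _∪_) renaming (⊥ to ∅)
open import Data.Fin.Subset.Properties using (_∈?_; x∈p∪q⁺)
open import Data.List.Membership.Propositional using () renaming (_∈_ to _∈ₗ_; _∉_ to _∉ₗ_)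
open import Data.List.Relation.Unary.All using ([]; _∷_) renaming (lookup to lookupAll)
open import Data.List.Relation.Unary.All.Properties using (¬Any⇒All¬)
open import Data.List.Relation.Unary.AllPairs using ([]; _∷_)
import Data.List.Relation.Unary.Any as Any
open import Data.List.Relation.Unary.Any using (here; there)
open import Data.List.Relation.Unary.Unique.Propositional using (Unique)
open import Data.Nat as ℕ using (zero; suc; z≤n; _≤′_; ≤′-refl; ≤′-step)
import Data.Nat.Properties as ℕ
open import Data.Nat.Induction using (<-wellFounded)
open import Data.Product using (Σ; ∃; ∃₂; _×_; _,_; proj₁; proj₂)
import Data.Product as Product
open import Data.Product.Properties using (≡-dec; ,-injective)
open import Data.Rational using (0ℚ; 1ℚ; _+_; _≤_; _<_)
open import Data.Rational.Properties
  using ( ≤-refl; ≤-trans; ≤-reflexive; ≤-<-trans; <-irrefl; positive⁻¹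
        ; +-mono-≤; +-monoʳ-≤; +-mono-<; +-identityˡ; +-identityʳ; +-0-commutativeMonoid )
open import Data.Sum using (_⊎_; inj₁; inj₂)
import Data.Sum as Sum
open import Data.Vec using (lookup; tabulate)
open import Data.Vec.Properties using ([]=⇒lookup; lookup⇒[]=; lookup∘tabulate; lookup-zipWith)
open import Function using (_∘_; _⇔_; mk⇔; Equivalence)
import Function.Properties.Equivalence as ⇔
open import Induction.WellFounded using (module All)
import Relation.Binary.Construct.On as On
open import Relation.Binary.PropositionalEquality using (_≡_; _≢_; refl; sym; trans; cong; subst)
open import Relation.Nullary using (Dec; yes; no; ¬_; does; proof; contradiction; ¬?)
open import Relation.Nullary.Reflects using (Reflects; invert)
open import Relation.Nullary.Decidable using (_×-dec_; _⊎-dec_; map′; decidable-stable; dec-true)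
open import Relation.Unary using (Decidable)

open import Algebra.Properties.CommutativeSemigroup
  (CommutativeMonoid.commutativeSemigroup +-0-commutativeMonoid) using (interchange)

module _ {P : ℕ → Set} (P? : Decidable P) (P-suc : ∀ {i} → P i → P (suc i)) where

  private
    P-mono : ∀ {i j} → i ≤′ j → P i → P j
    P-mono ≤′-refl       p = p
    P-mono (≤′-step i≤j) p = P-suc (P-mono i≤j p)

  least-witness : ∀ {L} → P L → Σ ℕ λ j → P j × (∀ {i} → P i → j ℕ.≤ i)
  least-witness {zero}  p = zero , p , λ _ → z≤n
  least-witness {suc L} p with P? L
  ... | yes q = least-witness q
  ... | no ¬q = suc L , p , λ q → ℕ.≰⇒> (λ i≤L → ¬q (P-mono (ℕ.≤⇒≤′ i≤L) q))

sumFin-mono : ∀ {k} {f g : Fin k → ℚ} → (∀ i → f i ≤ g i) → sumFin f ≤ sumFin g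
sumFin-mono {zero}  _   = ≤-refl
sumFin-mono {suc k} f≤g = +-mono-≤ (f≤g zero) (sumFin-mono (f≤g ∘ suc))

sumFin-+ : ∀ {k} (f g : Fin k → ℚ) → sumFin (λ i → f i + g i) ≡ sumFin f + sumFin g
sumFin-+ {zero}  _ _ = refl
sumFin-+ {suc k} f g = trans (cong (f zero + g zero +_) (sumFin-+ (f ∘ suc) (g ∘ suc)))
                             (interchange (f zero) (g zero) (sumFin (f ∘ suc)) (sumFin (g ∘ suc)))

module _ {q : ℚ} (q≥0 : 0ℚ ≤ q) where

  if-mono : ∀ {b c} → (b ≡ true → c ≡ true) → (if b then q else 0ℚ) ≤ (if c then q else 0ℚ)
  if-mono {false} {false} _   = ≤-refl
  if-mono {false} {true}  _   = q≥0
  if-mono {true}  {false} b⇒c = contradiction (b⇒c refl) λ ()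
  if-mono {true}  {true}  _   = ≤-refl

  if-∨ : ∀ b c → (if b ∨ c then q else 0ℚ) ≤ (if b then q else 0ℚ) + (if c then q else 0ℚ)
  if-∨ false false = ≤-refl
  if-∨ false true  = ≤-reflexive (sym (+-identityˡ q))
  if-∨ true  false = ≤-reflexive (sym (+-identityʳ q))
  if-∨ true  true  = subst (_≤ q + q) (+-identityʳ q) (+-monoʳ-≤ q q≥0)

sumSub-∅ : ∀ {k} (x : Fin k → ℚ) → sumSub ∅ x ≡ 0ℚ
sumSub-∅ {zero}  _ = refl
sumSub-∅ {suc k} x = cong (0ℚ +_) (sumSub-∅ (x ∘ suc))

module _ {k} {x : Fin k → ℚ} (x≥0 : ∀ e → 0ℚ ≤ x e) where

  sumSub-mono : ∀ {S S′ : Subset k} → S ⊆ S′ → sumSub S x ≤ sumSub S′ x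
  sumSub-mono {S} S⊆S′ =
    sumFin-mono λ e → if-mono (x≥0 e) λ e∈S → []=⇒lookup (S⊆S′ (lookup⇒[]= e S e∈S))

  sumSub-∪ : ∀ (S S′ : Subset k) → sumSub (S ∪ S′) x ≤ sumSub S x + sumSub S′ x
  sumSub-∪ S S′ = ≤-trans (sumFin-mono term-∪) (≤-reflexive (sumFin-+ {k} _ _))
    where
    term-∪ : ∀ e → (if lookup (S ∪ S′) e then x e else 0ℚ) ≤
                   (if lookup S e then x e else 0ℚ) + (if lookup S′ e then x e else 0ℚ)
    term-∪ e rewrite lookup-zipWith _∨_ e S S′ = if-∨ (x≥0 e) (lookup S e) (lookup S′ e)

Represents-tabulate : ∀ {k} {P : Fin k → Set} (P? : Decidable P) → Represents (tabulate (does ∘ P?)) P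
Represents-tabulate {P = P} P? e = to , from
  where
  lookup≡does : lookup (tabulate (does ∘ P?)) e ≡ does (P? e)
  lookup≡does = lookup∘tabulate _ e
  to : e ∈ tabulate (does ∘ P?) → P e
  to e∈S = invert (subst (Reflects (P e)) (trans (sym lookup≡does) ([]=⇒lookup e∈S)) (proof (P? e)))
  from : P e → e ∈ tabulate (does ∘ P?)
  from p = lookup⇒[]= e _ (trans lookup≡does (dec-true (P? e) p))

module GraphProperties (G : Graph) where
  open Graph G

  Joins-sym : ∀ {e u v} → Joins e u v → Joins e v u
  Joins-sym = Sum.swap

  Joins? : ∀ e u v → Dec (Joins e u v)
  Joins? e u v = ≡-dec _≟_ _≟_ (ends e) (u , v) ⊎-dec ≡-dec _≟_ _≟_ (ends e) (v , u)

  Joins-unique : ∀ {e a b c d} → Joins e a b → Joins e c d → (a ≡ c × b ≡ d) ⊎ (a ≡ d × b ≡ c)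
  Joins-unique (inj₁ p) (inj₁ q) = inj₁ (,-injective (trans (sym p) q))
  Joins-unique (inj₁ p) (inj₂ q) = inj₂ (,-injective (trans (sym p) q))
  Joins-unique (inj₂ p) (inj₁ q) = inj₂ (Product.swap (,-injective (trans (sym p) q)))
  Joins-unique (inj₂ p) (inj₂ q) = inj₁ (Product.swap (,-injective (trans (sym p) q)))

  head∈verts : ∀ {u v} (p : Walk u v) → u ∈ₗ verts p
  head∈verts (here _)     = here refl
  head∈verts (step _ _ _) = here refl

  endpoint∈verts : ∀ {u v e s t} (p : Walk u v) → e ∈ₗ edgesW p → Joins e s t → s ∈ₗ verts p
  endpoint∈verts (step _ J p) (here refl) J′ with Joins-unique J′ J
  ... | inj₁ (refl , _) = here refl
  ... | inj₂ (refl , _) = there (head∈verts p)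
  endpoint∈verts (step _ _ p) (there e∈p) J′ = there (endpoint∈verts p e∈p J′)

  suffix-path : ∀ {y u v} (p : Walk u v) → y ∈ₗ verts p → Unique (verts p) → Path y v
  suffix-path (here v)     (here refl) p-unique       = here v , p-unique
  suffix-path (step e J p) (here refl) p-unique       = step e J p , p-unique
  suffix-path (step _ _ p) (there y∈p) (_ ∷ p-unique) = suffix-path p y∈p p-unique

  walk⇒path : ∀ {u v} → Walk u v → Path u v
  walk⇒path (here v) = here v , [] ∷ []
  walk⇒path (step {u} e J p) with walk⇒path p
  ... | q , q-unique with Any.any? (u ≟_) (verts q)
  ...   | yes u∈q = suffix-path q u∈q q-unique
  ...   | no  u∉q = step e J q , ¬Any⇒All¬ _ u∉q ∷ q-unique

  first-edge : ∀ {u v} → Walk u v → u ≢ v → Fin k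
  first-edge (here _)     u≢u = contradiction refl u≢u
  first-edge (step e _ _) _   = e

module RootedTree (G : Graph) (connected : Graph.Connected G) (vertCount : Graph.m G ≡ suc (Graph.k G))
                  (root : Fin (Graph.m G)) (e₀ : Fin (Graph.k G)) where
  open Graph G
  open GraphProperties G

  -- Parent links come from breadth-first layers around the root, so no acyclicity argument is
  -- needed: the tree property enters only through the edge count, in parentEdge-surjective.
  Reach : ℕ → Fin m → Set
  Reach zero    v = v ≡ root
  Reach (suc j) v = Reach j v ⊎ ∃₂ λ e u → Joins e u v × Reach j u

  Reach? : ∀ j v → Dec (Reach j v)
  Reach? zero    v = v ≟ root
  Reach? (suc j) v = Reach? j v ⊎-dec any? λ e → any? λ u → Joins? e u v ×-dec Reach? j u

  walk⇒Reach : ∀ {v} → Walk v root → ∃ λ j → Reach j v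
  walk⇒Reach (here _)     = zero , refl
  walk⇒Reach (step e J p) = let j , R = walk⇒Reach p in suc j , inj₂ (e , _ , Joins-sym J , R)

  private
    least-Reach : ∀ v → Σ ℕ λ j → Reach j v × (∀ {i} → Reach i v → j ℕ.≤ i)
    least-Reach v = least-witness (λ j → Reach? j v) inj₁ (proj₂ (walk⇒Reach (connected v root)))

  depth : Fin m → ℕ
  depth v = proj₁ (least-Reach v)

  depth-minimal : ∀ {j v} → Reach j v → depth v ℕ.≤ j
  depth-minimal {v = v} = proj₂ (proj₂ (least-Reach v))

  root-or-link : ∀ v → v ≡ root ⊎ ∃₂ λ e u → Joins e u v × depth u ℕ.< depth v
  root-or-link v = link (depth v) (proj₁ (proj₂ (least-Reach v))) depth-minimal
    where
    link : ∀ j → Reach j v → (∀ {i} → Reach i v → j ℕ.≤ i) →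
           v ≡ root ⊎ ∃₂ λ e u → Joins e u v × depth u ℕ.< j
    link zero    v≡root                 _       = inj₁ v≡root
    link (suc j) (inj₁ R)               minimal = contradiction (minimal R) (ℕ.n≮n j)
    link (suc j) (inj₂ (e , u , J , R)) _       = inj₂ (e , u , J , ℕ.s≤s (depth-minimal R))

  -- At the root, parent and parentEdge return the junk values root and e₀.
  parent : Fin m → Fin m
  parent v with root-or-link v
  ... | inj₁ _           = v
  ... | inj₂ (_ , u , _) = u

  parentEdge : Fin m → Fin k
  parentEdge v with root-or-link v
  ... | inj₁ _       = e₀
  ... | inj₂ (e , _) = e

  parent-joins : ∀ {v} → v ≢ root → Joins (parentEdge v) (parent v) v
  parent-joins {v} v≢root with root-or-link v
  ... | inj₁ v≡root          = contradiction v≡root v≢root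
  ... | inj₂ (_ , _ , J , _) = J

  depth-parent : ∀ {v} → v ≢ root → depth (parent v) ℕ.< depth v
  depth-parent {v} v≢root with root-or-link v
  ... | inj₁ v≡root           = contradiction v≡root v≢root
  ... | inj₂ (_ , _ , _ , lt) = lt

  parent-induction : ∀ {ℓ} (P : Fin m → Set ℓ) → (∀ v → (v ≢ root → P (parent v)) → P v) → ∀ v → P v
  parent-induction {ℓ} P f =
    All.wfRec (On.wellFounded depth <-wellFounded) ℓ P λ v rec → f v (rec ∘ depth-parent)

  infix 4 _≼_
  data _≼_ (w : Fin m) : Fin m → Set where
    ≼-refl : w ≼ w
    ≼-step : ∀ {v} → v ≢ root → w ≼ parent v → w ≼ v

  ≼-trans : ∀ {u v w} → u ≼ v → v ≼ w → u ≼ w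
  ≼-trans u≼v ≼-refl               = u≼v
  ≼-trans u≼v (≼-step w≢root v≼pw) = ≼-step w≢root (≼-trans u≼v v≼pw)

  ≼-parent : ∀ {w v} → w ≼ v → w ≢ v → w ≼ parent v
  ≼-parent ≼-refl          w≢w = contradiction refl w≢w
  ≼-parent (≼-step _ w≼pv) _   = w≼pv

  ≼-depth : ∀ {w v} → w ≼ v → depth w ℕ.≤ depth v
  ≼-depth ≼-refl               = ℕ.≤-refl
  ≼-depth (≼-step v≢root w≼pv) = ℕ.≤-trans (≼-depth w≼pv) (ℕ.<⇒≤ (depth-parent v≢root))

  ⋠parent : ∀ {v} → v ≢ root → ¬ v ≼ parent v
  ⋠parent v≢root v≼pv = ℕ.<⇒≱ (depth-parent v≢root) (≼-depth v≼pv)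

  ≼root⇒≡root : ∀ {w} → w ≼ root → w ≡ root
  ≼root⇒≡root ≼-refl               = refl
  ≼root⇒≡root (≼-step root≢root _) = contradiction refl root≢root

  ≼-comparable : ∀ {u v w} → u ≼ w → v ≼ w → u ≼ v ⊎ v ≼ u
  ≼-comparable ≼-refl               v≼u             = inj₂ v≼u
  ≼-comparable (≼-step w≢root u≼pw) ≼-refl          = inj₁ (≼-step w≢root u≼pw)
  ≼-comparable (≼-step _ u≼pw)      (≼-step _ v≼pw) = ≼-comparable u≼pw v≼pw

  root≼ : ∀ v → root ≼ v
  root≼ = parent-induction (root ≼_) f
    where
    f : ∀ v → (v ≢ root → root ≼ parent v) → root ≼ v
    f v ih with v ≟ root
    ... | yes refl  = ≼-refl
    ... | no v≢root = ≼-step v≢root (ih v≢root)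

  ⋠⇒≢root : ∀ {v z} → ¬ v ≼ z → v ≢ root
  ⋠⇒≢root {z = z} v⋠z refl = v⋠z (root≼ z)

  _≼?_ : ∀ w v → Dec (w ≼ v)
  w ≼? v = parent-induction (λ v → Dec (w ≼ v)) f v
    where
    f : ∀ v → (v ≢ root → Dec (w ≼ parent v)) → Dec (w ≼ v)
    f v ih with w ≟ v | v ≟ root
    ... | yes refl | _         = yes ≼-refl
    ... | no w≢v   | yes refl  = no (w≢v ∘ ≼root⇒≡root)
    ... | no w≢v   | no v≢root = map′ (≼-step v≢root) (λ w≼v → ≼-parent w≼v w≢v) (ih v≢root)

  lca-child : ∀ {v z} → ¬ v ≼ z → ∃ λ t → t ≼ v × ¬ t ≼ z × parent t ≼ z
  lca-child {v} {z} = parent-induction P f v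
    where
    P : Fin m → Set
    P v = ¬ v ≼ z → ∃ λ t → t ≼ v × ¬ t ≼ z × parent t ≼ z
    f : ∀ v → (v ≢ root → P (parent v)) → P v
    f v ih v⋠z with parent v ≼? z
    ... | yes pv≼z = v , ≼-refl , v⋠z , pv≼z
    ... | no  pv⋠z = let t , t≼pv , rest = ih (⋠⇒≢root v⋠z) pv⋠z
                     in t , ≼-step (⋠⇒≢root v⋠z) t≼pv , rest

  parentEdge-injective : ∀ {v w} → v ≢ root → w ≢ root → parentEdge v ≡ parentEdge w → v ≡ w
  parentEdge-injective {v} {w} v≢root w≢root eq
    with Joins-unique (parent-joins v≢root)
                      (subst (λ e → Joins e (parent w) w) (sym eq) (parent-joins w≢root))
  ... | inj₁ (_ , v≡w)     = v≡w
  ... | inj₂ (pv≡w , v≡pw) = contradiction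
          (subst (λ u → depth u ℕ.< depth v) pv≡w (depth-parent v≢root))
          (ℕ.<-asym (subst (λ u → depth u ℕ.< depth w) (sym v≡pw) (depth-parent w≢root)))

  -- A tree has one vertex more than it has edges, so sending the root to a missed edge e
  -- would extend parentEdge to an injection Fin m → Fin k.
  parentEdge-surjective : ∀ e → ∃ λ w → w ≢ root × parentEdge w ≡ e
  parentEdge-surjective e with any? (λ w → ¬? (w ≟ root) ×-dec parentEdge w ≟ e)
  ... | yes hit  = hit
  ... | no  miss = contradiction (injective⇒≤ f-injective) (ℕ.<⇒≱ (ℕ.≤-reflexive (sym vertCount)))
    where
    f : Fin m → Fin k
    f w with w ≟ root
    ... | yes _ = e
    ... | no  _ = parentEdge w
    f-injective : ∀ {u w} → f u ≡ f w → u ≡ w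
    f-injective {u} {w} eq with u ≟ root | w ≟ root
    ... | yes u≡root | yes w≡root = trans u≡root (sym w≡root)
    ... | yes _      | no  w≢root = contradiction (w , w≢root , sym eq) miss
    ... | no  u≢root | yes _      = contradiction (u , u≢root , eq) miss
    ... | no  u≢root | no  w≢root = parentEdge-injective u≢root w≢root eq

  child : Fin k → Fin m
  child e = proj₁ (parentEdge-surjective e)

  child≢root : ∀ e → child e ≢ root
  child≢root e = proj₁ (proj₂ (parentEdge-surjective e))

  parentEdge-child : ∀ e → parentEdge (child e) ≡ e
  parentEdge-child e = proj₂ (proj₂ (parentEdge-surjective e))

  Joins-crossing : ∀ {e y y′ w} → Joins e y y′ → w ≼ y → ¬ w ≼ y′ → e ≡ parentEdge w
  Joins-crossing {e} {w = w} J w≼y w⋠y′ with parentEdge-surjective e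
  ... | c , c≢root , refl with Joins-unique J (parent-joins c≢root)
  ...   | inj₁ (refl , refl) = contradiction (≼-step c≢root w≼y) w⋠y′
  ...   | inj₂ (refl , refl) with w ≟ c
  ...     | yes refl = refl
  ...     | no  w≢c  = contradiction (≼-parent w≼y w≢c) w⋠y′

  Joins-respects-≼ : ∀ {e y y′ w} → Joins e y y′ → e ≢ parentEdge w → w ≼ y ⇔ w ≼ y′
  Joins-respects-≼ {w = w} J e≢pw = mk⇔ (preserve J) (preserve (Joins-sym J))
    where
    preserve : ∀ {a b} → Joins _ a b → w ≼ a → w ≼ b
    preserve {b = b} J′ w≼a = decidable-stable (w ≼? b) (e≢pw ∘ Joins-crossing J′ w≼a)

  walk-respects-≼ : ∀ {y z w} (p : Walk y z) → parentEdge w ∉ₗ edgesW p → w ≼ y ⇔ w ≼ z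
  walk-respects-≼ (here _)     _    = ⇔.refl
  walk-respects-≼ (step e J p) pw∉p =
    ⇔.trans (Joins-respects-≼ J (pw∉p ∘ here ∘ sym)) (walk-respects-≼ p (pw∉p ∘ there))

  Isolates : Fin m → Fin m → Fin m → Set
  Isolates w y z = w ≼ y × ¬ w ≼ z

  Separates : Fin m → Fin m → Fin m → Set
  Separates w y z = Isolates w y z ⊎ Isolates w z y

  Separates? : ∀ w y z → Dec (Separates w y z)
  Separates? w y z = (w ≼? y ×-dec ¬? (w ≼? z)) ⊎-dec (w ≼? z ×-dec ¬? (w ≼? y))

  path-edge⇒separates : ∀ {y z w} (p : Walk y z) → Unique (verts p) → w ≢ root →
                        parentEdge w ∈ₗ edgesW p → Separates w y z
  path-edge⇒separates {w = w} (step e J p) (y∉p ∷ p-unique) w≢root pw∈ with e ≟ parentEdge w | pw∈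
  ... | yes refl | _ = crossing J (walk-respects-≼ p pw∉p)
    where
    pw∉p : parentEdge w ∉ₗ edgesW p
    pw∉p pw∈p = lookupAll y∉p (endpoint∈verts p pw∈p J) refl
    crossing : ∀ {y y′ z} → Joins (parentEdge w) y y′ → w ≼ y′ ⇔ w ≼ z → Separates w y z
    crossing J′ y′~z with Joins-unique J′ (parent-joins w≢root)
    ... | inj₁ (refl , refl) = inj₂ (Equivalence.to y′~z ≼-refl , ⋠parent w≢root)
    ... | inj₂ (refl , refl) = inj₁ (≼-refl , ⋠parent w≢root ∘ Equivalence.from y′~z)
  ... | no e≢pw | here pw≡e  = contradiction (sym pw≡e) e≢pw
  ... | no e≢pw | there pw∈p =
    Sum.map (Product.map₁ (Equivalence.from y~y′)) (Product.map₂ (_∘ Equivalence.to y~y′))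
            (path-edge⇒separates p p-unique w≢root pw∈p)
    where y~y′ = Joins-respects-≼ J e≢pw

  path-between : ∀ u v → Path u v
  path-between u v = walk⇒path (connected u v)

  separates⇒path-edge : ∀ {w y z} → Separates w y z → EOnPath y z (parentEdge w)
  separates⇒path-edge {w} {y} {z} sep
    with Any.any? (parentEdge w ≟_) (edgesW (proj₁ (path-between y z)))
  ... | yes pw∈ = path-between y z , pw∈
  ... | no  pw∉ with walk-respects-≼ (proj₁ (path-between y z)) pw∉ | sep
  ...   | y~z | inj₁ (w≼y , w⋠z) = contradiction (Equivalence.to y~z w≼y) w⋠z
  ...   | y~z | inj₂ (w≼z , w⋠y) = contradiction (Equivalence.from y~z w≼z) w⋠y

  onPath⇒separates : ∀ {y z e} → EOnPath y z e → Separates (child e) y z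
  onPath⇒separates {e = e} ((p , p-unique) , e∈p) =
    path-edge⇒separates p p-unique (child≢root e) (subst (_∈ₗ edgesW p) (sym (parentEdge-child e)) e∈p)

  EOnPath? : ∀ y z e → Dec (EOnPath y z e)
  EOnPath? y z e = map′ (subst (EOnPath y z) (parentEdge-child e) ∘ separates⇒path-edge) onPath⇒separates
                        (Separates? (child e) y z)

  ≼⇒onRootPath : ∀ {w v} → w ≼ v → VOnPath root v w
  ≼⇒onRootPath {w} {v} w≼v with w ≟ root
  ... | yes refl  = path-between root v , head∈verts (proj₁ (path-between root v))
  ... | no w≢root =
    let P , pw∈P = separates⇒path-edge (inj₂ (w≼v , w≢root ∘ ≼root⇒≡root))
    in P , endpoint∈verts (proj₁ P) pw∈P (Joins-sym (parent-joins w≢root))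

  lca-child-≼ : ∀ {y z t w} → Isolates t y z → parent t ≼ z → Isolates w y z → t ≼ w
  lca-child-≼ {t = t} {w} (t≼y , _) pt≼z (w≼y , w⋠z) with ≼-comparable w≼y t≼y
  ... | inj₂ t≼w = t≼w
  ... | inj₁ w≼t with w ≟ t
  ...   | yes refl = ≼-refl
  ...   | no  w≢t  = contradiction (≼-trans (≼-parent w≼t w≢t) pt≼z) w⋠z

  isolates-between : ∀ {y z t w c} → Isolates t y z → Isolates w y z → t ≼ w → Separates c t w →
                     Isolates c y z
  isolates-between _ _ t≼w (inj₁ (c≼t , c⋠w)) = contradiction (≼-trans c≼t t≼w) c⋠w
  isolates-between (t≼y , t⋠z) (w≼y , _) t≼w (inj₂ (c≼w , c⋠t)) = c≼y , c⋠z
    where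
    c≼y = ≼-trans c≼w w≼y
    c⋠z : ¬ _ ≼ _
    c⋠z c≼z with ≼-comparable c≼y t≼y
    ... | inj₁ c≼t = c⋠t c≼t
    ... | inj₂ t≼c = t⋠z (≼-trans t≼c c≼z)

module Rounding {n} (T : PhyloTree n) (r : Fin n) (e₀ : Fin (PhyloTree.k T))
                (x : Fin (PhyloTree.k T) → ℚ) (x≥0 : ∀ e → 0ℚ ≤ x e)
                (E : Subset (PhyloTree.k T)) (stopped : Procedure.Stopped T r x E) where
  open PhyloTree T
  open RootedTree graph connected vertCount (leaf r) e₀
  open Procedure T r x using (root; InD; Lower; quarter)

  weight : Subset k → ℚ
  weight S = sumSub S x

  record LightCover (P : Fin m → Set) (bound : ℚ) : Set where
    field
      edges  : Subset k
      light  : weight edges < bound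
      covers : ∀ {w} → P w → parentEdge w ∈ edges
  open LightCover

  LightCover-⊎ : ∀ {P Q p q} → LightCover P p → LightCover Q q → LightCover (λ w → P w ⊎ Q w) (p + q)
  LightCover-⊎ C D = record
    { edges  = edges C ∪ edges D
    ; light  = ≤-<-trans (sumSub-∪ x≥0 (edges C) (edges D)) (+-mono-< (light C) (light D))
    ; covers = Sum.[ x∈p∪q⁺ ∘ inj₁ ∘ covers C , x∈p∪q⁺ ∘ inj₂ ∘ covers D ]
    }

  lower-parentEdge : ∀ {v} → v ≢ root → Lower (parentEdge v) v
  lower-parentEdge v≢root = parent _ , parent-joins v≢root , ≼⇒onRootPath (≼-step v≢root ≼-refl)

  isolates⇒InD : ∀ {y z t w} → (∀ {c} → Isolates c y z → parentEdge c ∉ E) →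
                 Isolates t y z → parent t ≼ z → Isolates w y z → InD E (parentEdge t) (parentEdge w)
  isolates⇒InD {t = t} {w} outsideE iso-t pt≼z iso-w =
    t , w , lower-parentEdge (⋠⇒≢root (proj₂ iso-t)) , lower-parentEdge (⋠⇒≢root (proj₂ iso-w)) ,
    ≼⇒onRootPath t≼w , no-E
    where
    t≼w = lca-child-≼ iso-t pt≼z iso-w
    no-E : ∀ g → g ∈ E → ¬ EOnPath t w g
    no-E g g∈E g-on = outsideE (isolates-between iso-t iso-w t≼w (onPath⇒separates g-on))
                               (subst (_∈ E) (sym (parentEdge-child g)) g∈E)

  isolating-cover : ∀ {y z} → (∀ {w} → Isolates w y z → parentEdge w ∉ E) →
                    LightCover (λ w → Isolates w y z) quarter
  isolating-cover {y} {z} outsideE with y ≼? z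
  ... | yes y≼z = record
    { edges  = ∅
    ; light  = subst (_< quarter) (sym (sumSub-∅ x)) (positive⁻¹ quarter)
    ; covers = λ (w≼y , w⋠z) → contradiction (≼-trans w≼y y≼z) w⋠z
    }
  ... | no y⋠z with lca-child y⋠z
  ...   | t , t≼y , t⋠z , pt≼z with stopped (parentEdge t) (outsideE (t≼y , t⋠z))
  ...     | _ , (S , represents , weight≡) , light = record
    { edges  = S
    ; light  = subst (_< quarter) (sym weight≡) light
    ; covers = λ iso → proj₂ (represents _) (isolates⇒InD outsideE (t≼y , t⋠z) pt≼z iso)
    }

  separating-cover : ∀ {y z} → (∀ {w} → Separates w y z → parentEdge w ∉ E) →
                     LightCover (λ w → Separates w y z) (quarter + quarter)
  separating-cover outsideE =
    LightCover-⊎ (isolating-cover (outsideE ∘ inj₁)) (isolating-cover (outsideE ∘ inj₂))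

  InL? : ∀ a b c d e → Dec (InL T a b c d e)
  InL? a b c d e = EOnPath? (leaf a) (leaf b) e ⊎-dec EOnPath? (leaf c) (leaf d) e

  L-light : ∀ {a b c d} → (∀ {e} → InL T a b c d e → e ∉ E) →
            ∀ {S} → Represents S (InL T a b c d) → weight S < 1ℚ
  L-light {a} {b} {c} {d} L∩E≡∅ {S} represents = ≤-<-trans (sumSub-mono x≥0 S⊆) (light C)
    where
    C : LightCover (λ w → Separates w (leaf a) (leaf b) ⊎ Separates w (leaf c) (leaf d)) 1ℚ
    C = LightCover-⊎ (separating-cover λ sep → L∩E≡∅ (inj₁ (separates⇒path-edge sep)))
                     (separating-cover λ sep → L∩E≡∅ (inj₂ (separates⇒path-edge sep)))
    S⊆ : S ⊆ edges C
    S⊆ {e} e∈S = subst (_∈ edges C) (parentEdge-child e)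
                   (covers C (Sum.map onPath⇒separates onPath⇒separates (proj₁ (represents e) e∈S)))

  quartet-hit : ∀ {s} (Ts : Fin s → PhyloTree n) → LPFeasible T Ts x →
                ∀ a b c d → InQ T Ts a b c d → Displays T a b c d → ∃ λ e → e ∈ E × InL T a b c d e
  quartet-hit _ feasible a b c d inQ displays with any? (λ e → e ∈? E ×-dec InL? a b c d e)
  ... | yes hit  = hit
  ... | no  miss = contradiction
    (≤-<-trans (proj₂ feasible a b c d inQ displays _ L-represented)
               (L-light (λ inL e∈E → miss (_ , e∈E , inL)) L-represented))
    (<-irrefl refl)
    where L-represented = Represents-tabulate (InL? a b c d)

lemma5 : ∀ {n s : ℕ} (T₁ : PhyloTree n) (Ts : Fin s → PhyloTree n)
         (x : Fin (PhyloTree.k T₁) → ℚ) → LPOptimal T₁ Ts x →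
         (r : Fin n) (E : Subset (PhyloTree.k T₁)) →
         Procedure.Reachable T₁ r x E → Procedure.Stopped T₁ r x E →
         IPFeasible T₁ Ts E
lemma5 T₁ Ts x (feasible , _) r E _ stopped a b c d inQ displays =
  Rounding.quartet-hit T₁ r e₀ x (proj₁ feasible) E stopped Ts feasible a b c d inQ displays
  where
  open PhyloTree T₁
  open GraphProperties graph
  e₀ = first-edge (connected (leaf a) (leaf b)) (proj₁ (proj₁ inQ) ∘ leaf-inj a b)
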